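{- Let $G$ be a finite simple bipartite graph with colour classes $V$ and $W$, where $\#V=v$ and $\#W=w$, and suppose $G$ contains no cycle of length $4$ and no cycle of length $6$. (i) If $w>\lfloor v^2/4\rfloor$, then at least $\lceil w-v^2/4\rceil$ vertices of $W$ have degree $0$ or $1$. (ii) If every vertex of $G$ has degree at least $2$, then $w\le\lfloor v^2/4\rfloor$ and $v\le\lfloor w^2/4\rfloor$.
   Context: Graphs are finite and simple. -}

module Defs where

open import Data.Nat using (ℕ; zero; suc; _+_)
open import Data.Fin using (Fin)
open import Data.Bool using (Bool; true; false; if_then_else_)
open import Relation.Binary.PropositionalEquality using (_≡_; _≢_)
open import Data.Product using (_×_)
open import Function using (_∘_)
open import Data.Empty using (⊥)

-- A finite simple bipartite graph with colour classes V = Fin v and W = Fin w,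
-- given by its (decidable) bipartite adjacency relation.
BipGraph : ℕ → ℕ → Set
BipGraph v w = Fin v → Fin w → Bool

count : ∀ {n} → (Fin n → Bool) → ℕ
count {zero}  p = 0
count {suc n} p = (if p Fin.zero then 1 else 0) + count (p ∘ Fin.suc)

Adj : ∀ {v w} → BipGraph v w → Fin v → Fin w → Set
Adj G a b = G a b ≡ true

degV : ∀ {v w} → BipGraph v w → Fin v → ℕ
degV G a = count (λ b → G a b)

degW : ∀ {v w} → BipGraph v w → Fin w → ℕ
degW G b = count (λ a → G a b)

NoC4 : ∀ {v w} → BipGraph v w → Set
NoC4 G = ∀ a₁ a₂ b₁ b₂ → a₁ ≢ a₂ → b₁ ≢ b₂ →
  Adj G a₁ b₁ → Adj G a₂ b₁ → Adj G a₂ b₂ → Adj G a₁ b₂ → ⊥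

NoC6 : ∀ {v w} → BipGraph v w → Set
NoC6 G = ∀ a₁ a₂ a₃ b₁ b₂ b₃ →
  a₁ ≢ a₂ → a₂ ≢ a₃ → a₁ ≢ a₃ → b₁ ≢ b₂ → b₂ ≢ b₃ → b₁ ≢ b₃ →
  Adj G a₁ b₁ → Adj G a₂ b₁ → Adj G a₂ b₂ → Adj G a₃ b₂ →
  Adj G a₃ b₃ → Adj G a₁ b₃ → ⊥

-- Give every vertex b ∈ W of degree at least 2 two distinct neighbours; this
-- is a multigraph on V with one edge per such b.  Two vertices of W share at
-- most one neighbour since there is no C₄, so the multigraph has no parallel
-- edges, and a triangle in it would be a C₆ of G.  By Mantel's theorem it has
-- at most ⌊v²/4⌋ edges: deleting both ends x, y of an edge from a set of m + 2
-- vertices loses that edge and at most one more per remaining vertex (no vertex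
-- is joined to both x and y), and ⌊(m+2)²/4⌋ = ⌊m²/4⌋ + m + 1.  This bounds the
-- number of vertices of W of degree at least 2, which gives (i); (ii) is the
-- same bound for G and for its transpose.
module Submission where

open import Defs
open import Data.Nat using (ℕ; _≤_; _<_; _*_; _∸_; _/_)
open import Data.Fin using (Fin)
open import Data.Product using (_×_)
open import Data.Bool using (Bool)
open import Data.Nat using (_≤ᵇ_)

open import Data.Nat using (zero; suc; _+_; z≤n; s≤s)
open import Data.Nat.Properties
  using (suc-injective; +-suc; ≤-pred; ≤-trans; ≤-reflexive; n≤1+n; >⇒≢; +-mono-≤; +-monoˡ-≤;
         ∸-monoʳ-≤; m+n∸n≡m; module ≤-Reasoning)
open import Data.Nat.DivMod using (+-distrib-/-∣ʳ; m*n/n≡m)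
open import Data.Nat.Divisibility using (divides)
open import Data.Nat.Solver using (module +-*-Solver)
open import Data.Fin using (zero; suc)
open import Data.Fin.Properties using (_≟_; 0≢1+n) renaming (suc-injective to Fin-suc-injective)
open import Data.Bool using (true; false; _∧_; not)
open import Data.Bool.Properties using (∧-conicalʳ; ∧-identityʳ; ¬-not)
open import Data.Empty using (⊥)
open import Data.Product using (∃; _,_; proj₁; proj₂)
open import Data.Sum using (_⊎_; inj₁; inj₂; [_,_]′)
open import Function using (_∘_)
open import Relation.Nullary using (Dec; does; yes; no; ¬_; contradiction)
open import Relation.Nullary.Decidable using (decidable-stable)
open import Relation.Binary.PropositionalEquality
  using (_≡_; _≢_; refl; sym; trans; cong; cong₂; subst; ≢-sym; module ≡-Reasoning)

_─_ : ∀ {n} → (Fin n → Bool) → Fin n → Fin n → Bool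
(P ─ j) i = P i ∧ not (does (i ≟ j))

─-intro : ∀ {n} (P : Fin n → Bool) {i j} → P i ≡ true → i ≢ j → (P ─ j) i ≡ true
─-intro P {i} {j} Pi i≢j with i ≟ j
... | yes i≡j = contradiction i≡j i≢j
... | no _ = cong (_∧ true) Pi

─-elim : ∀ {n} (P : Fin n → Bool) {i j} → (P ─ j) i ≡ true → P i ≡ true × i ≢ j
─-elim P {i} {j} h with P i | i ≟ j
─-elim P _  | true  | no i≢j = refl , i≢j
─-elim P () | true  | yes _
─-elim P () | false | _

count-cong : ∀ {n} {P Q : Fin n → Bool} → (∀ i → P i ≡ Q i) → count P ≡ count Q
count-cong {zero}          P≗Q = refl
count-cong {suc n} {P} {Q} P≗Q rewrite P≗Q zero = cong (_ +_) (count-cong (P≗Q ∘ suc))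

count-mono : ∀ {n} {P Q : Fin n → Bool} → (∀ i → P i ≡ true → Q i ≡ true) →
  count P ≤ count Q
count-mono {zero}          P⊆Q = z≤n
count-mono {suc n} {P} {Q} P⊆Q with P zero in P0 | Q zero in Q0
... | true  | true  = s≤s (count-mono (P⊆Q ∘ suc))
... | true  | false = contradiction (trans (sym Q0) (P⊆Q zero P0)) λ ()
... | false | true  = ≤-trans (count-mono (P⊆Q ∘ suc)) (n≤1+n _)
... | false | false = count-mono (P⊆Q ∘ suc)

count-false : ∀ {n} {P : Fin n → Bool} → (∀ i → P i ≡ false) → count P ≡ 0
count-false {zero}      _  = refl
count-false {suc n} {P} ¬P rewrite ¬P zero = count-false (¬P ∘ suc)

count-true : ∀ {n} {P : Fin n → Bool} → (∀ i → P i ≡ true) → count P ≡ n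
count-true {zero}      _  = refl
count-true {suc n} {P} ✓P rewrite ✓P zero = cong suc (count-true (✓P ∘ suc))

count-+-not : ∀ {n} (P : Fin n → Bool) → count P + count (not ∘ P) ≡ n
count-+-not {zero}  P = refl
count-+-not {suc n} P with P zero
... | true  = cong suc (count-+-not (P ∘ suc))
... | false = trans (+-suc _ _) (cong suc (count-+-not (P ∘ suc)))

count-split : ∀ {n} (P Q : Fin n → Bool) →
  count P ≡ count (λ i → P i ∧ Q i) + count (λ i → P i ∧ not (Q i))
count-split {zero}  P Q = refl
count-split {suc n} P Q with P zero | Q zero
... | true  | true  = cong suc (count-split (P ∘ suc) (Q ∘ suc))
... | true  | false = trans (cong suc (count-split (P ∘ suc) (Q ∘ suc))) (sym (+-suc _ _))
... | false | _     = count-split (P ∘ suc) (Q ∘ suc)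

count≡0⊎∃ : ∀ {n} (P : Fin n → Bool) → count P ≡ 0 ⊎ ∃ λ i → P i ≡ true
count≡0⊎∃ {zero}  P = inj₁ refl
count≡0⊎∃ {suc n} P with P zero in P0
... | true  = inj₂ (zero , P0)
... | false with count≡0⊎∃ (P ∘ suc)
...   | inj₁ none       = inj₁ none
...   | inj₂ (i , P1+i) = inj₂ (suc i , P1+i)

count-─ : ∀ {n} (P : Fin n → Bool) {j} → P j ≡ true → count P ≡ suc (count (P ─ j))
count-─ {suc n} P {zero} Pj rewrite Pj =
  cong suc (count-cong λ i → sym (∧-identityʳ (P (suc i))))
count-─ {suc n} P {suc j} Pj with P zero
... | true  = cong suc (count-─ (P ∘ suc) {j} Pj)
... | false = count-─ (P ∘ suc) {j} Pj

count-injective : ∀ {n m} {P : Fin n → Bool} {Q : Fin m → Bool} (f : Fin n → Fin m) →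
  (∀ {i} → P i ≡ true → Q (f i) ≡ true) →
  (∀ {i j} → P i ≡ true → P j ≡ true → f i ≡ f j → i ≡ j) →
  count P ≤ count Q
count-injective {zero} f maps inj = z≤n
count-injective {suc n} {P = P} {Q} f maps inj with P zero in P0
... | false = count-injective (f ∘ suc) maps (λ Pi Pj → Fin-suc-injective ∘ inj Pi Pj)
... | true  = subst (suc (count (P ∘ suc)) ≤_) (sym (count-─ Q (maps P0)))
  (s≤s (count-injective (f ∘ suc)
    (λ Pi → ─-intro Q (maps Pi) (λ f1+i≡f0 → 0≢1+n (sym (inj Pi P0 f1+i≡f0))))
    (λ Pi Pj → Fin-suc-injective ∘ inj Pi Pj)))

choose : ∀ {n} → Fin n → (Fin n → Bool) → Fin n
choose d P = [ (λ _ → d) , proj₁ ]′ (count≡0⊎∃ P)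

choose-correct : ∀ {n} (d : Fin n) (P : Fin n → Bool) → 0 < count P → P (choose d P) ≡ true
choose-correct d P pos with count≡0⊎∃ P
... | inj₁ none     = contradiction none (>⇒≢ pos)
... | inj₂ (_ , Pi) = Pi

[2+m]*[2+m]/4≡m*m/4+[1+m] : ∀ m → (2 + m) * (2 + m) / 4 ≡ m * m / 4 + suc m
[2+m]*[2+m]/4≡m*m/4+[1+m] m = begin
  (2 + m) * (2 + m) / 4     ≡⟨ cong (_/ 4) (square m) ⟩
  (m * m + suc m * 4) / 4   ≡⟨ +-distrib-/-∣ʳ (m * m) (divides (suc m) refl) ⟩
  m * m / 4 + suc m * 4 / 4 ≡⟨ cong (m * m / 4 +_) (m*n/n≡m (suc m) 4) ⟩
  m * m / 4 + suc m         ∎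
  where
  open ≡-Reasoning
  open +-*-Solver
  square : ∀ m → (2 + m) * (2 + m) ≡ m * m + suc m * 4
  square = solve 1 (λ m → (con 2 :+ m) :* (con 2 :+ m) := m :* m :+ (con 1 :+ m) :* con 4) refl

module EdgeFamily {v w} (E : Fin w → Bool) (p q : Fin w → Fin v) where

  Incident : Fin w → Fin v → Set
  Incident b x = p b ≡ x ⊎ q b ≡ x

  Joins : Fin w → Fin v → Fin v → Set
  Joins b x y = E b ≡ true × Incident b x × Incident b y

  Loopless : Set
  Loopless = ∀ {b} → E b ≡ true → p b ≢ q b

  NoParallelEdges : Set
  NoParallelEdges = ∀ {b b′ x y} → b ≢ b′ → x ≢ y → Joins b x y → Joins b′ x y → ⊥

  TriangleFree : Set
  TriangleFree = ∀ {b₁ b₂ b₃ x y z} → b₁ ≢ b₂ → b₂ ≢ b₃ → b₁ ≢ b₃ →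
    x ≢ y → y ≢ z → x ≢ z → Joins b₁ x y → Joins b₂ y z → Joins b₃ x z → ⊥

  inside : (Fin v → Bool) → Fin w → Bool
  inside U b = E b ∧ (U (p b) ∧ U (q b))

  edgesIn : (Fin v → Bool) → ℕ
  edgesIn U = count (inside U)

  inside-elim : ∀ U {b} → inside U b ≡ true → E b ≡ true × U (p b) ≡ true × U (q b) ≡ true
  inside-elim U {b} h with E b | U (p b) | U (q b)
  inside-elim U _ | true | true | true = refl , refl , refl
  inside-elim U () | false | _    | _
  inside-elim U () | true  | false | _
  inside-elim U () | true  | true  | false

  module _ (loopless : Loopless) (noParallel : NoParallelEdges) (triangleFree : TriangleFree) where

    module Peel (U : Fin v → Bool) (b₀ : Fin w) (b₀∈U : inside U b₀ ≡ true) where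

      x y : Fin v
      x = p b₀
      y = q b₀

      E-b₀ : E b₀ ≡ true
      E-b₀ = proj₁ (inside-elim U b₀∈U)

      x∈U : U x ≡ true
      x∈U = proj₁ (proj₂ (inside-elim U b₀∈U))

      y∈U : U y ≡ true
      y∈U = proj₂ (proj₂ (inside-elim U b₀∈U))

      x≢y : x ≢ y
      x≢y = loopless E-b₀

      b₀-joins : Joins b₀ x y
      b₀-joins = E-b₀ , inj₁ refl , inj₂ refl

      U′ : Fin v → Bool
      U′ = (U ─ x) ─ y

      ∈U′-intro : ∀ {a} → U a ≡ true → a ≢ x → a ≢ y → U′ a ≡ true
      ∈U′-intro Ua a≢x a≢y = ─-intro (U ─ x) (─-intro U Ua a≢x) a≢y

      ∈U′-elim : ∀ {a} → U′ a ≡ true → a ≢ x × a ≢ y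
      ∈U′-elim h = proj₂ (─-elim U (proj₁ (─-elim (U ─ x) h))) , proj₂ (─-elim (U ─ x) h)

      ∉U′ : ∀ {a} → U a ≡ true → U′ a ≢ true → a ≡ x ⊎ a ≡ y
      ∉U′ {a} Ua a∉U′ = decide (a ≟ x) (a ≟ y)
        where
        decide : Dec (a ≡ x) → Dec (a ≡ y) → a ≡ x ⊎ a ≡ y
        decide (yes a≡x) _         = inj₁ a≡x
        decide (no _)    (yes a≡y) = inj₂ a≡y
        decide (no a≢x)  (no a≢y)  = contradiction (∈U′-intro Ua a≢x a≢y) a∉U′

      count-U : count U ≡ 2 + count U′
      count-U = trans (count-─ U x∈U) (cong suc (count-─ (U ─ x) (─-intro U y∈U (≢-sym x≢y))))

      crossing : Fin w → Bool
      crossing b = inside U b ∧ not (inside U′ b)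

      crossing-elim : ∀ {b} → crossing b ≡ true → inside U b ≡ true × inside U′ b ≢ true
      crossing-elim {b} h with inside U b | inside U′ b
      crossing-elim _  | true  | false = refl , λ ()
      crossing-elim () | true  | true
      crossing-elim () | false | _

      crossing-b₀ : crossing b₀ ≡ true
      crossing-b₀ = cong₂ _∧_ b₀∈U (cong not (¬-not b₀∉U′))
        where
        b₀∉U′ : inside U′ b₀ ≢ true
        b₀∉U′ h = proj₁ (∈U′-elim (proj₁ (proj₂ (inside-elim U′ h)))) refl

      module CrossingEdge {b} (cr : crossing b ≡ true) where
        Eb : E b ≡ true
        Eb = proj₁ (inside-elim U (proj₁ (crossing-elim cr)))

        Up : U (p b) ≡ true
        Up = proj₁ (proj₂ (inside-elim U (proj₁ (crossing-elim cr))))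

        Uq : U (q b) ≡ true
        Uq = proj₂ (proj₂ (inside-elim U (proj₁ (crossing-elim cr))))

        ∉inside : inside U′ b ≢ true
        ∉inside = proj₂ (crossing-elim cr)

        p≢q : p b ≢ q b
        p≢q = loopless Eb

      otherEnd : ∀ {b} → Dec (p b ≡ x) → Dec (p b ≡ y) → Fin v
      otherEnd {b} (no _) (no _) = p b
      otherEnd {b} _      _      = q b

      other : Fin w → Fin v
      other b = otherEnd (p b ≟ x) (p b ≟ y)

      -- A crossing edge other than b₀ has exactly one endpoint in {x, y}:
      -- both would make it parallel to b₀.
      other-spec : ∀ {b} → crossing b ≡ true → b ≢ b₀ →
        U′ (other b) ≡ true × (Joins b x (other b) ⊎ Joins b y (other b))
      other-spec {b} cr b≢b₀ = spec (p b ≟ x) (p b ≟ y)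
        where
        open CrossingEdge cr
        spec : (p≟x : Dec (p b ≡ x)) (p≟y : Dec (p b ≡ y)) →
          U′ (otherEnd p≟x p≟y) ≡ true × (Joins b x (otherEnd p≟x p≟y) ⊎ Joins b y (otherEnd p≟x p≟y))
        spec (yes p≡x) _ =
          ∈U′-intro Uq (λ q≡x → p≢q (trans p≡x (sym q≡x)))
                       (λ q≡y → noParallel b≢b₀ x≢y (Eb , inj₁ p≡x , inj₂ q≡y) b₀-joins)
          , inj₁ (Eb , inj₁ p≡x , inj₂ refl)
        spec (no _) (yes p≡y) =
          ∈U′-intro Uq (λ q≡x → noParallel b≢b₀ x≢y (Eb , inj₂ q≡x , inj₁ p≡y) b₀-joins)
                       (λ q≡y → p≢q (trans p≡y (sym q≡y)))
          , inj₂ (Eb , inj₁ p≡y , inj₂ refl)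
        spec (no p≢x) (no p≢y) = p∈U′ ,
          [ (λ q≡x → inj₁ (Eb , inj₂ q≡x , inj₁ refl)) , (λ q≡y → inj₂ (Eb , inj₂ q≡y , inj₁ refl)) ]′
          (∉U′ Uq (λ q∈U′ → ∉inside (cong₂ _∧_ Eb (cong₂ _∧_ p∈U′ q∈U′))))
          where
          p∈U′ : U′ (p b) ≡ true
          p∈U′ = ∈U′-intro Up p≢x p≢y

      -- Two crossing edges with the same outer endpoint z are parallel if they
      -- meet the same vertex of {x, y}, and form a triangle with b₀ otherwise.
      other-≡⇒¬≢ : ∀ {b b′} → crossing b ≡ true → crossing b′ ≡ true →
        b ≢ b₀ → b′ ≢ b₀ → other b ≡ other b′ → ¬ b ≢ b′
      other-≡⇒¬≢ {b} {b′} cr cr′ b≢b₀ b′≢b₀ same b≢b′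
        with other-spec cr b≢b₀ | other-spec cr′ b′≢b₀
      ... | z∈U′ , inj₁ jx | _ , inj₁ jx′ =
        noParallel b≢b′ (≢-sym (proj₁ (∈U′-elim z∈U′))) jx (subst (Joins b′ x) (sym same) jx′)
      ... | z∈U′ , inj₂ jy | _ , inj₂ jy′ =
        noParallel b≢b′ (≢-sym (proj₂ (∈U′-elim z∈U′))) jy (subst (Joins b′ y) (sym same) jy′)
      ... | z∈U′ , inj₁ jx | _ , inj₂ jy′ =
        triangleFree (≢-sym b′≢b₀) (≢-sym b≢b′) (≢-sym b≢b₀) x≢y (≢-sym (proj₂ (∈U′-elim z∈U′)))
          (≢-sym (proj₁ (∈U′-elim z∈U′))) b₀-joins (subst (Joins b′ y) (sym same) jy′) jx
      ... | z∈U′ , inj₂ jy | _ , inj₁ jx′ =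
        triangleFree (≢-sym b≢b₀) b≢b′ (≢-sym b′≢b₀) x≢y (≢-sym (proj₂ (∈U′-elim z∈U′)))
          (≢-sym (proj₁ (∈U′-elim z∈U′))) b₀-joins jy (subst (Joins b′ x) (sym same) jx′)

      other-injective : ∀ {b b′} → (crossing ─ b₀) b ≡ true → (crossing ─ b₀) b′ ≡ true →
        other b ≡ other b′ → b ≡ b′
      other-injective {b} {b′} h h′ same = decidable-stable (b ≟ b′)
        (other-≡⇒¬≢ (proj₁ (─-elim crossing h)) (proj₁ (─-elim crossing h′))
          (proj₂ (─-elim crossing h)) (proj₂ (─-elim crossing h′)) same)

      edgesIn-peel : edgesIn U ≤ edgesIn U′ + suc (count U′)
      edgesIn-peel = begin
        edgesIn U                                ≡⟨ count-split (inside U) (inside U′) ⟩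
        count kept + count crossing              ≡⟨ cong (count kept +_) (count-─ crossing crossing-b₀) ⟩
        count kept + suc (count (crossing ─ b₀)) ≤⟨ +-mono-≤ kept≤ (s≤s crossing≤) ⟩
        edgesIn U′ + suc (count U′)              ∎
        where
        open ≤-Reasoning
        kept : Fin w → Bool
        kept b = inside U b ∧ inside U′ b

        kept≤ : count kept ≤ edgesIn U′
        kept≤ = count-mono λ b → ∧-conicalʳ (inside U b) (inside U′ b)

        crossing≤ : count (crossing ─ b₀) ≤ count U′
        crossing≤ = count-injective other
          (λ h → proj₁ (other-spec (proj₁ (─-elim crossing h)) (proj₂ (─-elim crossing h))))
          other-injective

    mantel-≡ : ∀ n U → count U ≡ n → edgesIn U ≤ n * n / 4
    mantel-≡ n U |U|≡n with count≡0⊎∃ (inside U)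
    ... | inj₁ noEdge      = subst (_≤ n * n / 4) (sym noEdge) z≤n
    ... | inj₂ (b₀ , b₀∈U) = peel n |U|≡n
      where
      open Peel U b₀ b₀∈U
      peel : ∀ n → count U ≡ n → edgesIn U ≤ n * n / 4
      peel zero          |U|≡0 = contradiction (trans (sym count-U) |U|≡0) λ ()
      peel (suc zero)    |U|≡1 = contradiction (trans (sym count-U) |U|≡1) λ ()
      peel (suc (suc m)) |U|≡2+m = begin
        edgesIn U                     ≤⟨ edgesIn-peel ⟩
        edgesIn U′ + suc (count U′)   ≡⟨ cong (λ k → edgesIn U′ + suc k) |U′|≡m ⟩
        edgesIn U′ + suc m            ≤⟨ +-monoˡ-≤ (suc m) (mantel-≡ m U′ |U′|≡m) ⟩
        m * m / 4 + suc m             ≡⟨ sym ([2+m]*[2+m]/4≡m*m/4+[1+m] m) ⟩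
        (2 + m) * (2 + m) / 4         ∎
        where
        open ≤-Reasoning
        |U′|≡m : count U′ ≡ m
        |U′|≡m = suc-injective (suc-injective (trans (sym count-U) |U|≡2+m))

    mantel : ∀ U → edgesIn U ≤ count U * count U / 4
    mantel U = mantel-≡ (count U) U refl

neighbours : ∀ {v w} → BipGraph v w → Fin w → Fin v → Bool
neighbours G b a = G a b

branching : ∀ {v w} → BipGraph v w → Fin w → Bool
branching G b = not (degW G b ≤ᵇ 1)

branching⇒2≤degW : ∀ {v w} (G : BipGraph v w) {b} → branching G b ≡ true → 2 ≤ degW G b
branching⇒2≤degW G {b} h with degW G b
branching⇒2≤degW G () | zero
branching⇒2≤degW G () | suc zero
branching⇒2≤degW G _  | suc (suc _) = s≤s (s≤s z≤n)

2≤degW⇒branching : ∀ {v w} (G : BipGraph v w) {b} → 2 ≤ degW G b → branching G b ≡ true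
2≤degW⇒branching G {b} 2≤d with degW G b
2≤degW⇒branching G (s≤s (s≤s _)) | suc (suc _) = refl

module BranchingEdges {v w} (G : BipGraph (suc v) w) where

  first second : Fin w → Fin (suc v)
  first  b = choose zero (neighbours G b)
  second b = choose zero (neighbours G b ─ first b)

  open EdgeFamily (branching G) first second public

  module _ {b} (b-branching : branching G b ≡ true) where

    first-adj : Adj G (first b) b
    first-adj = choose-correct zero (neighbours G b)
      (≤-trans (s≤s z≤n) (branching⇒2≤degW G b-branching))

    second-spec : (neighbours G b ─ first b) (second b) ≡ true
    second-spec = choose-correct zero (neighbours G b ─ first b)
      (≤-pred (subst (2 ≤_) (count-─ (neighbours G b) first-adj) (branching⇒2≤degW G b-branching)))

    second-adj : Adj G (second b) b
    second-adj = proj₁ (─-elim (neighbours G b) second-spec)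

    incident-adj : ∀ {a} → Incident b a → Adj G a b
    incident-adj (inj₁ refl) = first-adj
    incident-adj (inj₂ refl) = second-adj

  loopless : Loopless
  loopless b-branching = ≢-sym (proj₂ (─-elim (neighbours G _) (second-spec b-branching)))

  noParallelEdges : NoC4 G → NoParallelEdges
  noParallelEdges noC4 {b} {b′} {x} {y} b≢b′ x≢y (br , bx , by) (br′ , b′x , b′y) =
    noC4 x y b b′ x≢y b≢b′ (incident-adj br bx) (incident-adj br by)
      (incident-adj br′ b′y) (incident-adj br′ b′x)

  triangleFree : NoC6 G → TriangleFree
  triangleFree noC6 {b₁} {b₂} {b₃} {x} {y} {z} b₁≢b₂ b₂≢b₃ b₁≢b₃ x≢y y≢z x≢z
    (br₁ , b₁x , b₁y) (br₂ , b₂y , b₂z) (br₃ , b₃x , b₃z) =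
    noC6 x y z b₁ b₂ b₃ x≢y y≢z x≢z b₁≢b₂ b₂≢b₃ b₁≢b₃
      (incident-adj br₁ b₁x) (incident-adj br₁ b₁y) (incident-adj br₂ b₂y)
      (incident-adj br₂ b₂z) (incident-adj br₃ b₃z) (incident-adj br₃ b₃x)

count-branching≤ : ∀ {v w} (G : BipGraph v w) → NoC4 G → NoC6 G → count (branching G) ≤ v * v / 4
count-branching≤ {zero}  G _    _    = ≤-reflexive (count-false {P = branching G} λ _ → refl)
count-branching≤ {suc v} G noC4 noC6 = begin
  count (branching G)                           ≤⟨ count-mono {Q = inside all} (λ b br → cong₂ _∧_ br refl) ⟩
  edgesIn all                                   ≤⟨ mantel loopless (noParallelEdges noC4) (triangleFree noC6) all ⟩
  count all * count all / 4                     ≡⟨ cong (λ k → k * k / 4) (count-true {P = all} λ _ → refl) ⟩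
  suc v * suc v / 4                             ∎
  where
  open ≤-Reasoning
  open BranchingEdges G
  all : Fin (suc v) → Bool
  all _ = true

all-branching⇒w≤v*v/4 : ∀ {v w} (G : BipGraph v w) → NoC4 G → NoC6 G →
  (∀ b → 2 ≤ degW G b) → w ≤ v * v / 4
all-branching⇒w≤v*v/4 {v} G noC4 noC6 δ≥2 =
  subst (_≤ v * v / 4) (count-true (λ b → 2≤degW⇒branching G (δ≥2 b))) (count-branching≤ G noC4 noC6)

transpose : ∀ {v w} → BipGraph v w → BipGraph w v
transpose G a b = G b a

NoC4-transpose : ∀ {v w} (G : BipGraph v w) → NoC4 G → NoC4 (transpose G)
NoC4-transpose G noC4 a₁ a₂ b₁ b₂ a₁≢a₂ b₁≢b₂ e₁ e₂ e₃ e₄ =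
  noC4 b₁ b₂ a₁ a₂ b₁≢b₂ a₁≢a₂ e₁ e₄ e₃ e₂

NoC6-transpose : ∀ {v w} (G : BipGraph v w) → NoC6 G → NoC6 (transpose G)
NoC6-transpose G noC6 a₁ a₂ a₃ b₁ b₂ b₃ a₁≢a₂ a₂≢a₃ a₁≢a₃ b₁≢b₂ b₂≢b₃ b₁≢b₃ e₁ e₂ e₃ e₄ e₅ e₆ =
  noC6 b₁ b₂ b₃ a₂ a₃ a₁ b₁≢b₂ b₂≢b₃ b₁≢b₃ a₂≢a₃ (≢-sym a₁≢a₃) (≢-sym a₁≢a₂) e₂ e₃ e₄ e₅ e₆ e₁

proposition2p2 : ∀ {v w} (G : BipGraph v w) → NoC4 G → NoC6 G →
    ((v * v) / 4 < w → w ∸ (v * v) / 4 ≤ count (λ b → degW G b ≤ᵇ 1))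
    × ((∀ a → 2 ≤ degV G a) → (∀ b → 2 ≤ degW G b) →
       (w ≤ (v * v) / 4) × (v ≤ (w * w) / 4))
proposition2p2 {v} {w} G noC4 noC6 = many-low-degree , minimum-degree-2
  where
  low : Fin w → Bool
  low b = degW G b ≤ᵇ 1

  many-low-degree : v * v / 4 < w → w ∸ v * v / 4 ≤ count low
  many-low-degree _ = begin
    w ∸ v * v / 4                                  ≤⟨ ∸-monoʳ-≤ w (count-branching≤ G noC4 noC6) ⟩
    w ∸ count (branching G)                        ≡⟨ cong (_∸ count (branching G)) (sym (count-+-not low)) ⟩
    count low + count (branching G) ∸ count (branching G)
                                                   ≡⟨ m+n∸n≡m (count low) (count (branching G)) ⟩
    count low                                      ∎
    where open ≤-Reasoning

  minimum-degree-2 : (∀ a → 2 ≤ degV G a) → (∀ b → 2 ≤ degW G b) →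
    (w ≤ v * v / 4) × (v ≤ w * w / 4)
  minimum-degree-2 δV≥2 δW≥2 =
    all-branching⇒w≤v*v/4 G noC4 noC6 δW≥2 ,
    all-branching⇒w≤v*v/4 (transpose G) (NoC4-transpose G noC4) (NoC6-transpose G noC6) δV≥2
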